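{- Let $A=(a_0,\dots,a_{n-1})$ be an array of pairwise distinct numbers, $k_1<k_2$ positive integers, $\Delta=k_2-k_1$, and run the following greedy algorithm: set $i=0$; repeat: find the smallest $j\ge i$ such that $(a_i,\dots,a_j)$ contains an increasing subsequence of length $k_2$ (stop if none exists) — call $(i,j)$ the computed prefix; find the largest $q\le j$ such that $(a_q,\dots,a_j)$ contains an increasing subsequence of length $k_1$ — call $(q,j)$ the computed suffix; set $i=q$. Consider any two consecutive steps of the algorithm, and in the first of them let $P=(a,c)$ be the computed prefix and $S=(b,c)$ the computed suffix. Let $X=(x_1,\dots,x_{k_2})$ be the lexicographically minimal increasing subsequence of length $k_2$ in $(a_a,\dots,a_c)$ and $Y=(y_1,\dots,y_{k_1})$ the lexicographically minimal increasing subsequence of length $k_1$ in $(a_b,\dots,a_c)$, where $x_t,y_t$ denote positions. Then $y_i\ge x_{i+\Delta}$ for all $1\le i\le k_1$.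
   Context: Increasing subsequences are identified with their increasing sequences of positions; lexicographic minimality refers to comparing these position sequences lexicographically. -}

module Defs where

open import Level using (Level; _⊔_)
open import Data.Nat using (ℕ; zero; suc)
open import Data.Fin using (Fin; toℕ) renaming (_<_ to _<ᶠ_; _≤_ to _≤ᶠ_)
open import Data.Vec using (Vec; []; _∷_; lookup)
open import Data.Product using (Σ; _×_; ∃)
open import Data.Sum using (_⊎_)
open import Data.Empty using (⊥)
open import Relation.Nullary using (¬_)
open import Relation.Binary.PropositionalEquality using (_≡_)
open import Relation.Binary.Bundles using (StrictTotalOrder)

module _ {c ℓ₁ ℓ₂ : Level} (O : StrictTotalOrder c ℓ₁ ℓ₂) where
  open StrictTotalOrder O renaming (Carrier to C)

  Distinct : {n : ℕ} → (Fin n → C) → Set ℓ₁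
  Distinct {n} A = (p q : Fin n) → A p ≈ A q → p ≡ q

  IncSubIn : {n : ℕ} → (Fin n → C) → (k : ℕ) → Fin n → Fin n → Vec (Fin n) k → Set ℓ₂
  IncSubIn A k i j xs =
    ((s : Fin k) → (i ≤ᶠ lookup xs s) × (lookup xs s ≤ᶠ j))
    × ((s t : Fin k) → s <ᶠ t → (lookup xs s <ᶠ lookup xs t) × (A (lookup xs s) < A (lookup xs t)))

  HasInc : {n : ℕ} → (Fin n → C) → (k : ℕ) → Fin n → Fin n → Set ℓ₂
  HasInc {n} A k i j = Σ (Vec (Fin n) k) (IncSubIn A k i j)

  ComputedPrefix : {n : ℕ} → (Fin n → C) → (k₂ : ℕ) → Fin n → Fin n → Set ℓ₂
  ComputedPrefix {n} A k₂ i j =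
    (i ≤ᶠ j) × HasInc A k₂ i j × ((j' : Fin n) → i ≤ᶠ j' → HasInc A k₂ i j' → j ≤ᶠ j')

  ComputedSuffix : {n : ℕ} → (Fin n → C) → (k₁ : ℕ) → Fin n → Fin n → Set ℓ₂
  ComputedSuffix {n} A k₁ q j =
    (q ≤ᶠ j) × HasInc A k₁ q j × ((q' : Fin n) → q' ≤ᶠ j → HasInc A k₁ q' j → q' ≤ᶠ q)

  -- Values taken by the variable i during a run of the greedy algorithm.
  data Reach {n : ℕ} (A : Fin n → C) (k₁ k₂ : ℕ) : Fin n → Set ℓ₂ where
    start : (i : Fin n) → toℕ i ≡ 0 → Reach A k₁ k₂ i
    step  : {i j q : Fin n} → Reach A k₁ k₂ i → ComputedPrefix A k₂ i j →
            ComputedSuffix A k₁ q j → Reach A k₁ k₂ q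

LexLt : {n k : ℕ} → Vec (Fin n) k → Vec (Fin n) k → Set
LexLt [] [] = ⊥
LexLt (x ∷ xs) (y ∷ ys) = (x <ᶠ y) ⊎ ((x ≡ y) × LexLt xs ys)

module _ {c ℓ₁ ℓ₂ : Level} (O : StrictTotalOrder c ℓ₁ ℓ₂) where
  open StrictTotalOrder O renaming (Carrier to C)

  LexMinIncSub : {n : ℕ} → (Fin n → C) → (k : ℕ) → Fin n → Fin n → Vec (Fin n) k → Set ℓ₂
  LexMinIncSub {n} A k i j xs =
    IncSubIn O A k i j xs × ((zs : Vec (Fin n) k) → IncSubIn O A k i j zs → ¬ LexLt zs xs)

-- Write positions of X and Y as x₀ < x₁ < … and y₀ < y₁ < …, with Δ = k₂ − k₁, and show
-- x_{t+Δ} ≤ y_t by induction on t.  For t = 0, the last k₁ entries of X form an increasing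
-- subsequence starting at x_Δ and ending by c, so x_Δ ≤ b ≤ y₀ by maximality of the suffix.
-- If x_{t+Δ} ≤ y_t but y_{t+1} < x_{t+1+Δ}, compare the values at these two positions (they
-- differ, the entries being distinct).  If a[y_{t+1}] < a[x_{t+1+Δ}], then
-- y₁ … y_{t+1} x_{t+1+Δ} … is an increasing subsequence of length k₁ starting at y₁ > b,
-- against maximality of the suffix.  Otherwise x₀ … x_{t+Δ} y_{t+1} … is an increasing
-- subsequence of length k₂ in [a, c] lexicographically smaller than X.
module Submission where

open import Defs
open import Level using (Level)
open import Data.Nat using (ℕ; zero; suc; _≤_; _<_; _+_; _∸_; z≤n; z<s; s<s; _≤?_)
open import Data.Nat.Properties
open import Data.Nat.Tactic.RingSolver using (solve-∀)
open import Data.Fin using (Fin; toℕ; fromℕ<) renaming (_≤_ to _≤ᶠ_; _<_ to _<ᶠ_)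
open import Data.Fin.Properties using (toℕ-fromℕ<; toℕ<n)
open import Data.Vec using (Vec; []; _∷_; lookup; tabulate)
open import Data.Vec.Properties using (lookup∘tabulate)
open import Data.Product using (∃; _×_; _,_; proj₁; proj₂)
open import Data.Sum using (inj₁; inj₂)
open import Data.Empty using (⊥; ⊥-elim)
open import Relation.Nullary using (¬_; yes; no)
open import Relation.Binary.PropositionalEquality using (_≡_; refl; sym; trans; cong; subst; subst₂)
open import Relation.Binary.Bundles using (StrictTotalOrder)
open import Relation.Binary.Definitions using (tri<; tri≈; tri>)

lookupOr : {B : Set} {k : ℕ} → B → Vec B k → ℕ → B
lookupOr d []       _       = d
lookupOr d (x ∷ xs) zero    = x
lookupOr d (x ∷ xs) (suc m) = lookupOr d xs m

lookupOr-lookup : {B : Set} {k : ℕ} (d : B) (xs : Vec B k) (i : Fin k) →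
                  lookupOr d xs (toℕ i) ≡ lookup xs i
lookupOr-lookup d (x ∷ xs) Fin.zero    = refl
lookupOr-lookup d (x ∷ xs) (Fin.suc i) = lookupOr-lookup d xs i

tabulateℕ : {B : Set} (k : ℕ) → (ℕ → B) → Vec B k
tabulateℕ k h = tabulate (λ i → h (toℕ i))

lookupOr-tabulateℕ : {B : Set} {k m : ℕ} (d : B) (h : ℕ → B) → m < k →
                     lookupOr d (tabulateℕ k h) m ≡ h m
lookupOr-tabulateℕ {m = zero}  d h (s<s _) = refl
lookupOr-tabulateℕ {m = suc m} d h (s<s m<k) = lookupOr-tabulateℕ d (λ i → h (suc i)) m<k

+-rearrange : ∀ p j d → suc p + j + d ≡ j + d + suc p
+-rearrange = solve-∀

+-realign : ∀ k Δ t → k + Δ + suc t ≡ k + suc (t + Δ)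
+-realign = solve-∀

shift : {B : Set} → ℕ → (ℕ → B) → ℕ → B
shift d h j = h (j + d)

append : {B : Set} → ℕ → (ℕ → B) → (ℕ → B) → ℕ → B
append zero    f g m       = g m
append (suc p) f g zero    = f zero
append (suc p) f g (suc m) = append p (λ i → f (suc i)) g m

append-< : {B : Set} {p m : ℕ} (f g : ℕ → B) → m < p → append p f g m ≡ f m
append-< {p = suc p} {zero}  f g _         = refl
append-< {p = suc p} {suc m} f g (s<s m<p) = append-< (λ i → f (suc i)) g m<p

append-at : {B : Set} (p : ℕ) (f g : ℕ → B) → append p f g p ≡ g 0
append-at zero    f g = refl
append-at (suc p) f g = append-at p (λ i → f (suc i)) g

append-elim : {B : Set} {ℓ : Level} (P : B → Set ℓ) (p : ℕ) (f g : ℕ → B) (m : ℕ) →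
              (m < p → P (f m)) → (∀ j → m ≡ p + j → P (g j)) → P (append p f g m)
append-elim P zero    f g m       _  on-g = on-g m refl
append-elim P (suc p) f g zero    on-f _  = on-f z<s
append-elim P (suc p) f g (suc m) on-f on-g =
  append-elim P p (λ i → f (suc i)) g m (λ m<p → on-f (s<s m<p)) (λ j e → on-g j (cong suc e))

LexLt-intro : {n k r : ℕ} (d : Fin n) (ys xs : Vec (Fin n) k) → r < k →
              (∀ m → m < r → lookupOr d ys m ≡ lookupOr d xs m) →
              lookupOr d ys r <ᶠ lookupOr d xs r → LexLt ys xs
LexLt-intro {r = zero}  d (y ∷ ys) (x ∷ xs) _         _     y<x = inj₁ y<x
LexLt-intro {r = suc r} d (y ∷ ys) (x ∷ xs) (s<s r<k) agree y<x =
  inj₂ (agree 0 z<s , LexLt-intro d ys xs r<k (λ m m<r → agree (suc m) (s<s m<r)) y<x)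

module _ {ℓ ℓ₁ ℓ₂ : Level} (O : StrictTotalOrder ℓ ℓ₁ ℓ₂) {n : ℕ}
         (A : Fin n → StrictTotalOrder.Carrier O) where
  open StrictTotalOrder O using (compare) renaming (_<_ to _<ᴬ_; trans to <ᴬ-trans)

  _≺_ : Fin n → Fin n → Set ℓ₂
  u ≺ v = (u <ᶠ v) × (A u <ᴬ A v)

  ≺-trans : {u v w : Fin n} → u ≺ v → v ≺ w → u ≺ w
  ≺-trans (u<v , Au<Av) (v<w , Av<Aw) = <-trans u<v v<w , <ᴬ-trans Au<Av Av<Aw

  -- ℕ-indexed counterparts of IncSubIn, meaningful on the indices below k
  Increasing : ℕ → (ℕ → Fin n) → Set ℓ₂
  Increasing k h = ∀ m₁ m₂ → m₁ < m₂ → m₂ < k → h m₁ ≺ h m₂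

  Within : ℕ → Fin n → Fin n → (ℕ → Fin n) → Set
  Within k lo hi h = ∀ m → m < k → (lo ≤ᶠ h m) × (h m ≤ᶠ hi)

  IncSeq : ℕ → Fin n → Fin n → (ℕ → Fin n) → Set ℓ₂
  IncSeq k lo hi h = Within k lo hi h × Increasing k h

  Increasing-≺ˡ : {k m₁ m₂ : ℕ} {h : ℕ → Fin n} {w : Fin n} → Increasing k h →
                  m₁ ≤ m₂ → m₂ < k → h m₂ ≺ w → h m₁ ≺ w
  Increasing-≺ˡ {m₁ = m₁} {m₂} inc m₁≤m₂ m₂<k h₂≺w with m≤n⇒m<n∨m≡n m₁≤m₂
  ... | inj₁ m₁<m₂ = ≺-trans (inc m₁ m₂ m₁<m₂ m₂<k) h₂≺w
  ... | inj₂ refl  = h₂≺w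

  Increasing-≺ʳ : {k m₁ m₂ : ℕ} {h : ℕ → Fin n} {w : Fin n} → Increasing k h →
                  m₁ ≤ m₂ → m₂ < k → w ≺ h m₁ → w ≺ h m₂
  Increasing-≺ʳ {m₁ = m₁} {m₂} inc m₁≤m₂ m₂<k w≺h₁ with m≤n⇒m<n∨m≡n m₁≤m₂
  ... | inj₁ m₁<m₂ = ≺-trans w≺h₁ (inc m₁ m₂ m₁<m₂ m₂<k)
  ... | inj₂ refl  = w≺h₁

  Increasing-≤ : {k m₁ m₂ : ℕ} {h : ℕ → Fin n} → Increasing k h →
                 m₁ ≤ m₂ → m₂ < k → h m₁ ≤ᶠ h m₂
  Increasing-≤ {m₁ = m₁} {m₂} inc m₁≤m₂ m₂<k with m≤n⇒m<n∨m≡n m₁≤m₂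
  ... | inj₁ m₁<m₂ = <⇒≤ (proj₁ (inc m₁ m₂ m₁<m₂ m₂<k))
  ... | inj₂ refl  = ≤-refl

  IncSubIn⇒IncSeq : {k : ℕ} {i j : Fin n} (xs : Vec (Fin n) k) →
                    IncSubIn O A k i j xs → IncSeq k i j (lookupOr i xs)
  IncSubIn⇒IncSeq {k} {i} xs (within , increasing) = within′ , increasing′
    where
    at : ∀ m (m<k : m < k) → lookupOr i xs m ≡ lookup xs (fromℕ< m<k)
    at m m<k = trans (cong (lookupOr i xs) (sym (toℕ-fromℕ< m<k))) (lookupOr-lookup i xs (fromℕ< m<k))
    within′ : Within k _ _ (lookupOr i xs)
    within′ m m<k rewrite at m m<k = within (fromℕ< m<k)
    increasing′ : Increasing k (lookupOr i xs)
    increasing′ m₁ m₂ m₁<m₂ m₂<k rewrite at m₁ (<-trans m₁<m₂ m₂<k) | at m₂ m₂<k =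
      increasing _ _ (subst₂ _<_ (sym (toℕ-fromℕ< _)) (sym (toℕ-fromℕ< m₂<k)) m₁<m₂)

  IncSeq⇒IncSubIn : {k : ℕ} {i j : Fin n} (h : ℕ → Fin n) →
                    IncSeq k i j h → IncSubIn O A k i j (tabulateℕ k h)
  IncSeq⇒IncSubIn {k} {i} {j} h (within , increasing) = within′ , increasing′
    where
    at : ∀ s → lookup (tabulateℕ k h) s ≡ h (toℕ s)
    at = lookup∘tabulate (λ s → h (toℕ s))
    within′ : ∀ s → (i ≤ᶠ lookup (tabulateℕ k h) s) × (lookup (tabulateℕ k h) s ≤ᶠ j)
    within′ s rewrite at s = within (toℕ s) (toℕ<n s)
    increasing′ : ∀ s t → s <ᶠ t → lookup (tabulateℕ k h) s ≺ lookup (tabulateℕ k h) t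
    increasing′ s t s<t rewrite at s | at t = increasing (toℕ s) (toℕ t) s<t (toℕ<n t)

  IncSeq-shorten : {k K : ℕ} {lo hi : Fin n} {h : ℕ → Fin n} → k ≤ K →
                   IncSeq K lo hi h → IncSeq k lo hi h
  IncSeq-shorten k≤K (within , increasing) =
    (λ m m<k → within m (<-≤-trans m<k k≤K)) ,
    (λ m₁ m₂ m₁<m₂ m₂<k → increasing m₁ m₂ m₁<m₂ (<-≤-trans m₂<k k≤K))

  IncSeq-tail : {k d : ℕ} {lo hi : Fin n} {h : ℕ → Fin n} →
                IncSeq (k + d) lo hi h → IncSeq k (h d) hi (shift d h)
  IncSeq-tail {k} {d} (within , increasing) =
    (λ j j<k → Increasing-≤ increasing (m≤n+m d j) (+-monoˡ-< d j<k) ,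
               proj₂ (within (j + d) (+-monoˡ-< d j<k))) ,
    (λ j₁ j₂ j₁<j₂ j₂<k → increasing (j₁ + d) (j₂ + d) (+-monoˡ-< d j₁<j₂) (+-monoˡ-< d j₂<k))

  -- The spliced sequence has length K; the length condition says that the tail of h from d
  -- supplies exactly the K − (p + 1) terms still missing after the first p + 1 terms of f.
  IncSeq-append : {p L d K : ℕ} {lo lo′ hi : Fin n} {f h : ℕ → Fin n} →
                  IncSeq (suc p) lo hi f → IncSeq L lo′ hi h → L + suc p ≡ K + d → f p ≺ h d →
                  IncSeq K lo hi (append (suc p) f (shift d h))
  IncSeq-append {p} {L} {d} {K} {lo} {hi = hi} {f} {h} (f-within , f-inc) (h-within , h-inc) lengths junction =
    within , increasing
    where
    tail< : ∀ {m j} → m < K → m ≡ suc p + j → j + d < L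
    tail< {m} {j} m<K refl = +-cancelʳ-< (suc p) (j + d) L
      (subst₂ _<_ (+-rearrange p j d) (sym lengths) (+-monoˡ-< d m<K))
    f≺tail : ∀ {m j} → m < suc p → j + d < L → f m ≺ h (j + d)
    f≺tail {j = j} m<p j+d<L =
      Increasing-≺ˡ f-inc (<⇒≤pred m<p) (n<1+n p) (Increasing-≺ʳ h-inc (m≤n+m d j) j+d<L junction)
    within : Within K lo hi (append (suc p) f (shift d h))
    within m m<K = append-elim (λ z → (lo ≤ᶠ z) × (z ≤ᶠ hi)) (suc p) f (shift d h) m
      (f-within m)
      (λ j e → ≤-trans (proj₁ (f-within 0 z<s)) (<⇒≤ (proj₁ (f≺tail z<s (tail< m<K e)))) ,
               proj₂ (h-within (j + d) (tail< m<K e)))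
    increasing : Increasing K (append (suc p) f (shift d h))
    increasing m₁ m₂ m₁<m₂ m₂<K =
      append-elim (λ z → z ≺ append (suc p) f (shift d h) m₂) (suc p) f (shift d h) m₁
        (λ m₁<p → append-elim (f m₁ ≺_) (suc p) f (shift d h) m₂
           (f-inc m₁ m₂ m₁<m₂)
           (λ j₂ e₂ → f≺tail m₁<p (tail< m₂<K e₂)))
        (λ j₁ e₁ → append-elim (shift d h j₁ ≺_) (suc p) f (shift d h) m₂
           (λ m₂<p → ⊥-elim (<⇒≱ (<-trans m₁<m₂ m₂<p) (subst (suc p ≤_) (sym e₁) (m≤m+n (suc p) j₁))))
           (λ j₂ e₂ → h-inc (j₁ + d) (j₂ + d)
              (+-monoˡ-< d (+-cancelˡ-< (suc p) j₁ j₂ (subst₂ _<_ e₁ e₂ m₁<m₂)))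
              (tail< m₂<K e₂)))

  LexMinimal : ℕ → Fin n → Fin n → (ℕ → Fin n) → Set ℓ₂
  LexMinimal k i j x = ∀ h r → IncSeq k i j h → r < k → (∀ m → m < r → h m ≡ x m) → ¬ (h r <ᶠ x r)

  MaximalStart : ℕ → Fin n → Fin n → Set ℓ₂
  MaximalStart k j b = ∀ q h → q ≤ᶠ j → IncSeq k q j h → q ≤ᶠ b

  LexMinIncSub⇒LexMinimal : {k : ℕ} {i j : Fin n} (X : Vec (Fin n) k) →
                            LexMinIncSub O A k i j X → LexMinimal k i j (lookupOr i X)
  LexMinIncSub⇒LexMinimal {k} {i} X (_ , minimal) h r h-seq r<k agree h<x =
    minimal (tabulateℕ k h) (IncSeq⇒IncSubIn h h-seq)
      (LexLt-intro i (tabulateℕ k h) X r<k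
         (λ m m<r → trans (lookupOr-tabulateℕ i h (<-trans m<r r<k)) (agree m m<r))
         (subst (_<ᶠ lookupOr i X r) (sym (lookupOr-tabulateℕ i h r<k)) h<x))

  ComputedSuffix⇒MaximalStart : {k : ℕ} {b j : Fin n} →
                                ComputedSuffix O A k b j → MaximalStart k j b
  ComputedSuffix⇒MaximalStart (_ , _ , maximal) q h q≤j h-seq =
    maximal q q≤j (tabulateℕ _ h , IncSeq⇒IncSubIn h h-seq)

  module Domination (distinct : Distinct O A) {k₁ Δ : ℕ} {a b c : Fin n} {x y : ℕ → Fin n}
                    (x-seq : IncSeq (k₁ + Δ) a c x) (x-min : LexMinimal (k₁ + Δ) a c x)
                    (y-seq : IncSeq k₁ b c y) (b-max : MaximalStart k₁ c b) where

    no-longer-suffix : ∀ {t} → suc t < k₁ → y (suc t) <ᶠ x (suc t + Δ) →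
                       A (y (suc t)) <ᴬ A (x (suc t + Δ)) → ⊥
    no-longer-suffix {t} t+1<k₁ y<x Ay<Ax = <⇒≱ (proj₁ (proj₂ y-seq 0 1 z<s 1<k₁)) (≤-trans y₁≤b b≤y₀)
      where
      1<k₁ : 1 < k₁
      1<k₁ = ≤-<-trans (s<s z≤n) t+1<k₁
      junction : y (t + 1) ≺ x (suc t + Δ)
      junction = subst (_≺ x (suc t + Δ)) (cong y (+-comm 1 t)) (y<x , Ay<Ax)
      spliced : IncSeq k₁ (y 1) c (append (suc t) (shift 1 y) (shift (suc t + Δ) x))
      spliced = IncSeq-append (IncSeq-tail (IncSeq-shorten (subst (_≤ k₁) (+-comm 1 (suc t)) t+1<k₁) y-seq))
                              x-seq (+-realign k₁ Δ t) junction
      y₁≤b : y 1 ≤ᶠ b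
      y₁≤b = b-max (y 1) _ (proj₂ (proj₁ y-seq 1 1<k₁)) spliced
      b≤y₀ : b ≤ᶠ y 0
      b≤y₀ = proj₁ (proj₁ y-seq 0 (<-trans z<s 1<k₁))

    no-smaller-prefix : ∀ {t} → suc t < k₁ → x (t + Δ) ≤ᶠ y t → y (suc t) <ᶠ x (suc t + Δ) →
                        A (x (suc t + Δ)) <ᴬ A (y (suc t)) → ⊥
    no-smaller-prefix {t} t+1<k₁ x≤y y<x Ax<Ay =
      x-min _ (suc t + Δ) spliced s<k (λ m m<s → append-< x (shift (suc t) y) m<s)
        (subst (_<ᶠ x (suc t + Δ)) (sym (append-at (suc t + Δ) x (shift (suc t) y))) y<x)
      where
      s<k : suc t + Δ < k₁ + Δ
      s<k = +-monoˡ-< Δ t+1<k₁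
      junction : x (t + Δ) ≺ y (suc t)
      junction = ≤-<-trans x≤y (proj₁ (proj₂ y-seq t (suc t) (n<1+n t) t+1<k₁)) ,
                 <ᴬ-trans (proj₂ (proj₂ x-seq (t + Δ) (suc t + Δ) (n<1+n _) s<k)) Ax<Ay
      spliced : IncSeq (k₁ + Δ) a c (append (suc t + Δ) x (shift (suc t) y))
      spliced = IncSeq-append (IncSeq-shorten (<⇒≤ s<k) x-seq) y-seq (sym (+-realign k₁ Δ t)) junction

    x-below-y : ∀ t → t < k₁ → x (t + Δ) ≤ᶠ y t
    x-below-y zero 0<k₁ =
      ≤-trans (b-max (x Δ) (shift Δ x) (proj₂ (proj₁ x-seq Δ (+-monoˡ-< Δ 0<k₁))) (IncSeq-tail x-seq))
              (proj₁ (proj₁ y-seq 0 0<k₁))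
    x-below-y (suc t) t+1<k₁ with toℕ (x (suc t + Δ)) ≤? toℕ (y (suc t))
    ... | yes x≤y = x≤y
    ... | no x≰y with compare (A (y (suc t))) (A (x (suc t + Δ)))
    ...   | tri< Ay<Ax _ _ = ⊥-elim (no-longer-suffix t+1<k₁ (≰⇒> x≰y) Ay<Ax)
    ...   | tri≈ _ Ay≈Ax _ = ⊥-elim (<-irrefl (cong toℕ (distinct _ _ Ay≈Ax)) (≰⇒> x≰y))
    ...   | tri> _ _ Ax<Ay =
      ⊥-elim (no-smaller-prefix t+1<k₁ (x-below-y t (<-trans (n<1+n t) t+1<k₁)) (≰⇒> x≰y) Ax<Ay)

  lexMin-below-suffix : Distinct O A → {k₁ k₂ Δ : ℕ} → k₁ + Δ ≡ k₂ → {a b c : Fin n} →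
                        ComputedSuffix O A k₁ b c →
                        (X : Vec (Fin n) k₂) → LexMinIncSub O A k₂ a c X →
                        (Y : Vec (Fin n) k₁) → IncSubIn O A k₁ b c Y →
                        (t : Fin k₁) (s : Fin k₂) → toℕ s ≡ toℕ t + Δ → lookup X s ≤ᶠ lookup Y t
  lexMin-below-suffix distinct refl {a} {b} suffix X X-min Y Y-inc t s s≡t+Δ =
    subst₂ _≤ᶠ_ (trans (cong (lookupOr a X) (sym s≡t+Δ)) (lookupOr-lookup a X s)) (lookupOr-lookup b Y t)
      (Domination.x-below-y distinct
         (IncSubIn⇒IncSeq X (proj₁ X-min)) (LexMinIncSub⇒LexMinimal X X-min)
         (IncSubIn⇒IncSeq Y Y-inc) (ComputedSuffix⇒MaximalStart suffix)
         (toℕ t) (toℕ<n t))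

lemma8 : {c ℓ₁ ℓ₂ : Level} (O : StrictTotalOrder c ℓ₁ ℓ₂) {n : ℕ}
    (A : Fin n → StrictTotalOrder.Carrier O) → Distinct O A →
    (k₁ k₂ : ℕ) → 1 ≤ k₁ → k₁ < k₂ →
    (a b c : Fin n) →
    Reach O A k₁ k₂ a →
    ComputedPrefix O A k₂ a c →
    ComputedSuffix O A k₁ b c →
    (∃ λ c' → ComputedPrefix O A k₂ b c') →
    (X : Vec (Fin n) k₂) → LexMinIncSub O A k₂ a c X →
    (Y : Vec (Fin n) k₁) → LexMinIncSub O A k₁ b c Y →
    (t : Fin k₁) (s : Fin k₂) → toℕ s ≡ toℕ t + (k₂ ∸ k₁) →
    lookup X s ≤ᶠ lookup Y t
lemma8 O A distinct k₁ k₂ _ k₁<k₂ a b c _ _ suffix _ X X-min Y (Y-inc , _) =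
  lexMin-below-suffix O A distinct (m+[n∸m]≡n (<⇒≤ k₁<k₂)) suffix X X-min Y Y-inc
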